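{- Let $T$ be a tree on $n$ vertices and let $k$ be a positive integer. Then the number of edges of $T^k$ satisfies $|E(T^k)| \geq kn - \frac{1}{2}k(k+1)$.
   Context: For a graph $G$ and a positive integer $k$, the $k$th power $G^k$ is the graph with vertex set $V(G)$ in which two distinct vertices are adjacent if and only if their distance in $G$ is at most $k$. -}

module Defs where

open import Data.Nat using (ℕ; zero; suc; _+_; _<ᵇ_)
open import Data.Bool using (Bool; true; false; _∧_; _∨_; not; if_then_else_)
open import Data.Fin using (Fin; zero; suc; toℕ; fromℕ; inject₁; _≟_)
open import Data.List using (List; allFin; map)
open import Data.Bool.ListAction using (any)
open import Data.Nat.ListAction using (sum)
open import Data.Product using (Σ; ∃; _×_)
open import Relation.Nullary using (¬_)
open import Relation.Nullary.Decidable using (⌊_⌋)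
open import Relation.Binary.PropositionalEquality using (_≡_)
open import Function.Definitions using (Injective)

record Graph (n : ℕ) : Set where
  field
    adj       : Fin n → Fin n → Bool
    adj-sym   : ∀ u v → adj u v ≡ adj v u
    adj-irref : ∀ v → adj v v ≡ false
open Graph public

data Walk {n : ℕ} (G : Graph n) : Fin n → Fin n → ℕ → Set where
  nil  : ∀ {v} → Walk G v v zero
  cons : ∀ {u w v m} → adj G u w ≡ true → Walk G w v m → Walk G u v (suc m)

Connected : ∀ {n} → Graph n → Set
Connected {n} G = ∀ (u v : Fin n) → ∃ λ m → Walk G u v m

-- A cycle of length ℓ = 3 + m: pairwise distinct vertices c 0, …, c (ℓ-1)
-- with c i ~ c (i+1) and c (ℓ-1) ~ c 0.
Cycle : ∀ {n} → Graph n → Set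
Cycle {n} G =
  Σ ℕ λ m → Σ (Fin (suc (suc (suc m))) → Fin n) λ c →
    Injective _≡_ _≡_ c
    × (∀ (i : Fin (suc (suc m))) → adj G (c (inject₁ i)) (c (suc i)) ≡ true)
    × adj G (c (fromℕ (suc (suc m)))) (c zero) ≡ true

Acyclic : ∀ {n} → Graph n → Set
Acyclic G = ¬ Cycle G

IsTree : ∀ {n} → Graph n → Set
IsTree G = Connected G × Acyclic G

-- within G m u v = true  iff  dist_G(u,v) ≤ m
-- (u within distance 0 of v iff u = v; within m+1 iff within m or
--  u has a neighbour within distance m of v).
within : ∀ {n} → Graph n → ℕ → Fin n → Fin n → Bool
within G zero    u v = ⌊ u ≟ v ⌋
within {n} G (suc m) u v =
  within G m u v ∨ any (λ w → adj G u w ∧ within G m w v) (allFin n)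

powAdj : ∀ {n} → Graph n → ℕ → Fin n → Fin n → Bool
powAdj G k u v = not ⌊ u ≟ v ⌋ ∧ within G k u v

edgeCount : ∀ {n} → (Fin n → Fin n → Bool) → ℕ
edgeCount {n} a =
  sum (map (λ u → sum (map (λ v →
         if (toℕ u <ᵇ toℕ v) ∧ a u v then 1 else 0) (allFin n))) (allFin n))

powEdges : ∀ {n} → Graph n → ℕ → ℕ
powEdges G k = edgeCount (powAdj G k)

module Submission where

-- Starting from one vertex, grow a vertex
-- set S that stays connected, each time adding a vertex x ∉ S joined by an edge
-- to some s ∈ S, until S is everything. Because S is connected, the ball of
-- radius i around s inside S gains a vertex at every radius until it fills S
-- (`ball-size`); so at least min(k, |S|) vertices of S lie within distance k - 1
-- of s, hence within distance k of x (`attach-degree`). Adding x therefore adds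
-- at least 2 min(k, |S|) ordered adjacent pairs of G^k inside S (`pairs-insert`),
-- and the sum of these increments is at least 2kn - k(k+1) (`bound-step`).

open import Defs
open import Data.Nat using (ℕ; zero; suc; _+_; _*_; _∸_; _⊓_; _≤_; _<_; _<ᵇ_; z≤n; s≤s)
open import Data.Nat.Properties hiding (_≟_)
open import Data.Nat.Tactic.RingSolver using (solve-∀)
open import Data.Bool using (Bool; true; false; T; _∧_; _∨_; not; if_then_else_)
open import Data.Bool.Properties using (T?; T-∧; T-∨; T-≡; ∨-identityʳ; ∧-zeroʳ)
open import Data.Fin using (Fin; zero; suc; toℕ; _≟_; punchIn)
open import Data.Fin.Properties using (all?; ¬∀⟶∃¬; toℕ-injective; punchInᵢ≢i)
open import Data.List using (tabulate; map; allFin)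
open import Data.List.Properties using (map-tabulate)
open import Data.List.Relation.Unary.Any using (satisfied)
open import Data.List.Relation.Unary.Any.Properties using (any⁺; any⁻)
open import Data.List.Membership.Propositional using (lose)
open import Data.List.Membership.Propositional.Properties using (∈-allFin)
import Data.Nat.ListAction as List
open import Data.Product using (∃; _×_; _,_; proj₂)
import Data.Product
open import Data.Sum using (_⊎_; inj₁; inj₂)
import Data.Sum as Sum
open import Data.Unit using (tt)
open import Data.Empty using (⊥; ⊥-elim)
open import Function using (_∘_; _$_; id; Equivalence)
open import Relation.Nullary using (¬_; Dec; yes; no; contradiction)
open import Relation.Nullary.Decidable
  using (⌊_⌋; _→-dec_; isYes≗does; dec-true; dec-false; toWitness; fromWitness; decidable-stable)
open import Relation.Binary.PropositionalEquality
open import Algebra.Properties.CommutativeMonoid.Sum +-0-commutativeMonoid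
  using (sum; sum-syntax; sum-cong-≗; sum-remove; sum-replicate-zero; ∑-distrib-+; ∑-comm)

open Equivalence using (to; from)

⟦_⟧ : Bool → ℕ
⟦ b ⟧ = if b then 1 else 0

⟦⟧-mono : ∀ {b c} → (T b → T c) → ⟦ b ⟧ ≤ ⟦ c ⟧
⟦⟧-mono {false}        _   = z≤n
⟦⟧-mono {true} {true}  _   = ≤-refl
⟦⟧-mono {true} {false} b→c = ⊥-elim (b→c tt)

⟦⟧-< : ∀ {b c} → ¬ T b → T c → ⟦ b ⟧ < ⟦ c ⟧
⟦⟧-< {false} {true} _ _ = s≤s z≤n
⟦⟧-< {true}         ¬b _ = contradiction tt ¬b

⟦⟧-∨ : ∀ b c → (T b → T c → ⊥) → ⟦ b ∨ c ⟧ ≡ ⟦ b ⟧ + ⟦ c ⟧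
⟦⟧-∨ false c     _        = refl
⟦⟧-∨ true  false _        = refl
⟦⟧-∨ true  true  disjoint = ⊥-elim (disjoint tt tt)

⟦⟧-split : ∀ p q a → (T p → T q → ⊥) → (¬ T p → ¬ T q → ¬ T a) →
  ⟦ p ∧ a ⟧ + ⟦ q ∧ a ⟧ ≡ ⟦ a ⟧
⟦⟧-split false false false _    _       = refl
⟦⟧-split false false true  _    neither = ⊥-elim (neither id id tt)
⟦⟧-split false true  _     _    _       = refl
⟦⟧-split true  false false _    _       = refl
⟦⟧-split true  false true  _    _       = refl
⟦⟧-split true  true  _     both _       = ⊥-elim (both tt tt)

T-ext : ∀ {a b} → (T a → T b) → (T b → T a) → a ≡ b
T-ext {false} {false} _   _   = refl
T-ext {false} {true}  _   b→a = ⊥-elim (b→a tt)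
T-ext {true}  {false} a→b _   = ⊥-elim (a→b tt)
T-ext {true}  {true}  _   _   = refl

≟-refl : ∀ {n} (x : Fin n) → ⌊ x ≟ x ⌋ ≡ true
≟-refl x = trans (isYes≗does (x ≟ x)) (dec-true (x ≟ x) refl)

≟-≢ : ∀ {n} {x y : Fin n} → x ≢ y → ⌊ x ≟ y ⌋ ≡ false
≟-≢ {x = x} {y} x≢y = trans (isYes≗does (x ≟ y)) (dec-false (x ≟ y) x≢y)

∑-allFin : ∀ {n} (f : Fin n → ℕ) → List.sum (map f (allFin n)) ≡ ∑[ i < n ] f i
∑-allFin {n} f = trans (cong List.sum (map-tabulate id f)) (∑-tabulate f)
  where
  ∑-tabulate : ∀ {m} (g : Fin m → ℕ) → List.sum (tabulate g) ≡ ∑[ i < m ] g i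
  ∑-tabulate {zero}  g = refl
  ∑-tabulate {suc m} g = cong (g zero +_) (∑-tabulate (g ∘ suc))

∑-mono : ∀ {n} {f g : Fin n → ℕ} → (∀ i → f i ≤ g i) → ∑[ i < n ] f i ≤ ∑[ i < n ] g i
∑-mono {zero}  f≤g = z≤n
∑-mono {suc n} f≤g = +-mono-≤ (f≤g zero) (∑-mono (f≤g ∘ suc))

∑-mono-< : ∀ {n} {f g : Fin n → ℕ} → (∀ i → f i ≤ g i) →
  ∀ j → f j < g j → ∑[ i < n ] f i < ∑[ i < n ] g i
∑-mono-< f≤g zero    fj<gj = +-mono-<-≤ fj<gj (∑-mono (f≤g ∘ suc))
∑-mono-< f≤g (suc j) fj<gj = +-mono-≤-< (f≤g zero) (∑-mono-< (f≤g ∘ suc) j fj<gj)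

∑-select : ∀ {n} (x : Fin n) (f : Fin n → ℕ) →
  ∑[ i < n ] (if ⌊ i ≟ x ⌋ then f i else 0) ≡ f x
∑-select {suc n} x f = begin
  ∑[ i < suc n ] g i                    ≡⟨ sum-remove {i = x} g ⟩
  g x + ∑[ j < n ] g (punchIn x j)      ≡⟨ cong₂ _+_ at-x (trans (sum-cong-≗ off-x) (sum-replicate-zero n)) ⟩
  f x + 0                               ≡⟨ +-identityʳ (f x) ⟩
  f x                                   ∎
  where
  open ≡-Reasoning
  g : Fin (suc n) → ℕ
  g i = if ⌊ i ≟ x ⌋ then f i else 0
  at-x : g x ≡ f x
  at-x = cong (λ b → if b then f x else 0) (≟-refl x)
  off-x : ∀ j → g (punchIn x j) ≡ 0
  off-x j = cong (λ b → if b then f (punchIn x j) else 0)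
                 (≟-≢ (punchInᵢ≢i x j))

∑∑ : ∀ {n} → (Fin n → Fin n → ℕ) → ℕ
∑∑ {n} f = ∑[ u < n ] ∑[ v < n ] f u v

∑∑-distrib-+ : ∀ {n} (f g : Fin n → Fin n → ℕ) → ∑∑ (λ u v → f u v + g u v) ≡ ∑∑ f + ∑∑ g
∑∑-distrib-+ {n} f g = trans (sum-cong-≗ (λ u → ∑-distrib-+ (f u) (g u)))
  (∑-distrib-+ (λ u → ∑[ v < n ] f u v) (λ u → ∑[ v < n ] g u v))

VertexSet : ℕ → Set
VertexSet n = Fin n → Bool

size : ∀ {n} → VertexSet n → ℕ
size {n} S = ∑[ v < n ] ⟦ S v ⟧

_⊆_ : ∀ {n} → VertexSet n → VertexSet n → Set
S ⊆ S' = ∀ v → T (S v) → T (S' v)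

full : ∀ {n} → VertexSet n
full _ = true

singleton : ∀ {n} → Fin n → VertexSet n
singleton x v = ⌊ v ≟ x ⌋

insert : ∀ {n} → Fin n → VertexSet n → VertexSet n
insert x S v = S v ∨ ⌊ v ≟ x ⌋

singleton-member : ∀ {n} {x v : Fin n} → T (singleton x v) → v ≡ x
singleton-member = toWitness

singleton-self : ∀ {n} (x : Fin n) → T (singleton x x)
singleton-self x = fromWitness refl

singleton-⊆ : ∀ {n} {S : VertexSet n} {x} → T (S x) → singleton x ⊆ S
singleton-⊆ {S = S} x∈S v v∈ = subst (T ∘ S) (sym (singleton-member v∈)) x∈S

⊆-insert : ∀ {n} (S : VertexSet n) x → S ⊆ insert x S
⊆-insert S x v v∈S = from (T-∨ {S v}) (inj₁ v∈S)

insert-new : ∀ {n} (S : VertexSet n) x → T (insert x S x)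
insert-new S x = from (T-∨ {S x}) (inj₂ (singleton-self x))

insert-cases : ∀ {n} (S : VertexSet n) x {v} → T (insert x S v) → T (S v) ⊎ v ≡ x
insert-cases S x v∈ = Sum.map₂ toWitness (to T-∨ v∈)

inclusion? : ∀ {n} (S S' : VertexSet n) v → Dec (T (S v) → T (S' v))
inclusion? S S' v = T? (S v) →-dec T? (S' v)

⊆-or-escape : ∀ {n} (S S' : VertexSet n) → S ⊆ S' ⊎ ∃ λ v → T (S v) × ¬ T (S' v)
⊆-or-escape {n} S S' with all? (inclusion? S S')
... | yes S⊆S' = inj₁ λ v → S⊆S' v
... | no  S⊈S' = inj₂ (Data.Product.map₂ escapes (¬∀⟶∃¬ n _ (inclusion? S S') S⊈S'))
  where
  escapes : ∀ {v} → ¬ (T (S v) → T (S' v)) → T (S v) × ¬ T (S' v)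
  escapes {v} ¬incl =
    decidable-stable (T? (S v)) (λ v∉S → ¬incl (λ v∈S → contradiction v∈S v∉S)) ,
    λ v∈S' → ¬incl (λ _ → v∈S')

size-mono : ∀ {n} {S S' : VertexSet n} → S ⊆ S' → size S ≤ size S'
size-mono S⊆S' = ∑-mono (λ v → ⟦⟧-mono (S⊆S' v))

size-grows : ∀ {n} {S S' : VertexSet n} → S ⊆ S' →
  ∀ {y} → T (S' y) → ¬ T (S y) → size S < size S'
size-grows S⊆S' {y} y∈S' y∉S = ∑-mono-< (λ v → ⟦⟧-mono (S⊆S' v)) y (⟦⟧-< y∉S y∈S')

size-full : ∀ {n} → size (full {n}) ≡ n
size-full {zero}  = refl
size-full {suc n} = cong suc (size-full {n})

size-singleton : ∀ {n} (x : Fin n) → size (singleton x) ≡ 1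
size-singleton x = ∑-select x (λ _ → 1)

size-insert : ∀ {n} {S : VertexSet n} {x} → ¬ T (S x) → size (insert x S) ≡ suc (size S)
size-insert {n} {S} {x} x∉S = begin
  ∑[ v < n ] ⟦ S v ∨ ⌊ v ≟ x ⌋ ⟧                ≡⟨ sum-cong-≗ (λ v → ⟦⟧-∨ (S v) _ (disjoint v)) ⟩
  ∑[ v < n ] (⟦ S v ⟧ + ⟦ ⌊ v ≟ x ⌋ ⟧)          ≡⟨ ∑-distrib-+ (⟦_⟧ ∘ S) (⟦_⟧ ∘ singleton x) ⟩
  size S + size (singleton x)                   ≡⟨ cong (size S +_) (size-singleton x) ⟩
  size S + 1                                    ≡⟨ +-comm (size S) 1 ⟩
  suc (size S)                                  ∎
  where
  open ≡-Reasoning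
  disjoint : ∀ v → T (S v) → T (singleton x v) → ⊥
  disjoint v v∈S v≡x = x∉S (subst (T ∘ S) (singleton-member v≡x) v∈S)

module _ {n} (G : Graph n) where

  adj-sym-T : ∀ {u v} → T (adj G u v) → T (adj G v u)
  adj-sym-T {u} {v} = subst T (adj-sym G u v)

  within-weaken : ∀ m {u v} → T (within G m u v) → T (within G (suc m) u v)
  within-weaken m h = from T-∨ (inj₁ h)

  within-step : ∀ m {u w v} → T (adj G u w) → T (within G m w v) → T (within G (suc m) u v)
  within-step m {u} {w} {v} u~w h =
    from (T-∨ {within G m u v}) (inj₂ (any⁺ _ (lose (∈-allFin w) (from T-∧ (u~w , h)))))

  within-cases : ∀ m {u v} → T (within G (suc m) u v) →
    T (within G m u v) ⊎ ∃ λ w → T (adj G u w) × T (within G m w v)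
  within-cases m h =
    Sum.map₂ (λ h' → Data.Product.map₂ (to T-∧) (satisfied (any⁻ _ (allFin n) h'))) (to T-∨ h)

  within-refl : ∀ m {u} → T (within G m u u)
  within-refl zero    = fromWitness refl
  within-refl (suc m) = within-weaken m (within-refl m)

  within-snoc : ∀ m {u w v} → T (within G m u w) → T (adj G w v) → T (within G (suc m) u v)
  within-snoc zero    h w~v with refl ← toWitness h = within-step 0 w~v (within-refl 0)
  within-snoc (suc m) h w~v with within-cases m h
  ... | inj₁ h'             = within-weaken (suc m) (within-snoc m h' w~v)
  ... | inj₂ (_ , u~w' , h') = within-step (suc m) u~w' (within-snoc m h' w~v)

  -- Distance is symmetric; needed to see that G^k is a graph.
  within-sym : ∀ m {u v} → T (within G m u v) → T (within G m v u)
  within-sym zero    h with refl ← toWitness h = within-refl 0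
  within-sym (suc m) h with within-cases m h
  ... | inj₁ h'            = within-weaken m (within-sym m h')
  ... | inj₂ (_ , u~w , h') = within-snoc m (within-sym m h') (adj-sym-T u~w)

power : ∀ {n} → Graph n → ℕ → Graph n
power G k = record
  { adj       = powAdj G k
  ; adj-sym   = λ u v → cong₂ (λ e w → not e ∧ w)
                  (T-ext (fromWitness ∘ sym ∘ toWitness) (fromWitness ∘ sym ∘ toWitness))
                  (T-ext (within-sym G k) (within-sym G k))
  ; adj-irref = λ v → cong (λ e → not e ∧ within G k v v) (≟-refl v)
  }

power-adj : ∀ {n} (G : Graph n) k {u v} → u ≢ v → T (within G k u v) → T (adj (power G k) u v)
power-adj G k {u} {v} u≢v h = from T-∧ (subst (T ∘ not) (sym (≟-≢ u≢v)) tt , h)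

-- Ordered pairs of adjacent vertices of S: twice the number of edges of H[S].
pairs : ∀ {n} → Graph n → VertexSet n → ℕ
pairs H S = ∑∑ λ u v → ⟦ S u ∧ (S v ∧ adj H u v) ⟧

neighbours : ∀ {n} → Graph n → VertexSet n → Fin n → VertexSet n
neighbours H S x v = S v ∧ adj H x v

degree : ∀ {n} → Graph n → VertexSet n → Fin n → ℕ
degree H S x = size (neighbours H S x)

pairs-mono : ∀ {n} (H : Graph n) {S S' : VertexSet n} → S ⊆ S' → pairs H S ≤ pairs H S'
pairs-mono H {S} {S'} S⊆S' = ∑-mono λ u → ∑-mono λ v → ⟦⟧-mono λ h →
  let u∈S , rest = to T-∧ h
      v∈S , u~v  = to T-∧ rest
  in from T-∧ (S⊆S' u u∈S , from T-∧ (S⊆S' v v∈S , u~v))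

pairs-insert : ∀ {n} (H : Graph n) {S : VertexSet n} {x} → ¬ T (S x) →
  pairs H (insert x S) ≡ pairs H S + 2 * degree H S x
pairs-insert {n} H {S} {x} x∉S = begin
  pairs H (insert x S)                         ≡⟨ sum-cong-≗ (λ u → sum-cong-≗ (split u)) ⟩
  ∑∑ (λ u v → inside u v + from-x u v + to-x u v)
                                               ≡⟨ ∑∑-distrib-+ (λ u v → inside u v + from-x u v) to-x ⟩
  ∑∑ (λ u v → inside u v + from-x u v) + ∑∑ to-x
                                               ≡⟨ cong (_+ ∑∑ to-x) (∑∑-distrib-+ inside from-x) ⟩
  pairs H S + ∑∑ from-x + ∑∑ to-x              ≡⟨ cong₂ (λ a b → pairs H S + a + b) ∑from-x ∑to-x ⟩
  pairs H S + degree H S x + degree H S x      ≡⟨ +-assoc (pairs H S) (degree H S x) _ ⟩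
  pairs H S + (degree H S x + degree H S x)    ≡⟨ cong (λ d → pairs H S + (degree H S x + d)) (+-identityʳ _) ⟨
  pairs H S + 2 * degree H S x                 ∎
  where
  open ≡-Reasoning
  inside from-x to-x : Fin n → Fin n → ℕ
  inside u v = ⟦ S u ∧ (S v ∧ adj H u v) ⟧
  from-x u v = if ⌊ u ≟ x ⌋ then ⟦ S v ∧ adj H u v ⟧ else 0
  to-x   u v = if ⌊ v ≟ x ⌋ then ⟦ S u ∧ adj H u v ⟧ else 0

  Sx≡false : S x ≡ false
  Sx≡false = T-ext x∉S λ ()

  split : ∀ u v → ⟦ insert x S u ∧ (insert x S v ∧ adj H u v) ⟧ ≡ inside u v + from-x u v + to-x u v
  split u v with u ≟ x | v ≟ x
  ... | yes refl | yes refl rewrite Sx≡false | adj-irref H u = refl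
  ... | yes refl | no _ rewrite Sx≡false | ∨-identityʳ (S v) = sym (+-identityʳ _)
  ... | no _ | yes refl rewrite Sx≡false | ∨-identityʳ (S u) | ∧-zeroʳ (S u) = refl
  ... | no _ | no _ rewrite ∨-identityʳ (S u) | ∨-identityʳ (S v) =
    sym (trans (+-identityʳ _) (+-identityʳ _))

  ∑from-x : ∑∑ from-x ≡ degree H S x
  ∑from-x = trans (∑-comm from-x) (sum-cong-≗ (λ v → ∑-select x (λ u → ⟦ S v ∧ adj H u v ⟧)))

  ∑to-x : ∑∑ to-x ≡ degree H S x
  ∑to-x = sum-cong-≗ λ u →
    trans (∑-select x (λ v → ⟦ S u ∧ adj H u v ⟧)) (cong (λ b → ⟦ S u ∧ b ⟧) (adj-sym H u x))

handshake : ∀ {n} (H : Graph n) → 2 * edgeCount (adj H) ≡ pairs H full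
handshake {n} H = begin
  2 * edgeCount (adj H)  ≡⟨ cong (2 *_) as-∑ ⟩
  2 * ∑∑ lower           ≡⟨ cong (∑∑ lower +_) (+-identityʳ (∑∑ lower)) ⟩
  ∑∑ lower + ∑∑ lower    ≡⟨ cong (∑∑ lower +_) mirror ⟩
  ∑∑ lower + ∑∑ upper    ≡⟨ sym (∑∑-distrib-+ lower upper) ⟩
  ∑∑ (λ u v → lower u v + upper u v)
                         ≡⟨ sum-cong-≗ (λ u → sum-cong-≗ (λ v →
                              ⟦⟧-split _ _ _ (exclusive u v) (exhaustive u v))) ⟩
  pairs H full           ∎
  where
  open ≡-Reasoning
  lower upper : Fin n → Fin n → ℕ
  lower u v = ⟦ (toℕ u <ᵇ toℕ v) ∧ adj H u v ⟧
  upper u v = ⟦ (toℕ v <ᵇ toℕ u) ∧ adj H u v ⟧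

  as-∑ : edgeCount (adj H) ≡ ∑∑ lower
  as-∑ = trans (∑-allFin (λ u → List.sum (map (lower u) (allFin n))))
               (sum-cong-≗ (λ u → ∑-allFin (lower u)))

  mirror : ∑∑ lower ≡ ∑∑ upper
  mirror = trans (∑-comm lower) (sum-cong-≗ λ u → sum-cong-≗ λ v →
             cong (λ b → ⟦ (toℕ v <ᵇ toℕ u) ∧ b ⟧) (adj-sym H v u))

  exclusive : ∀ u v → T (toℕ u <ᵇ toℕ v) → T (toℕ v <ᵇ toℕ u) → ⊥
  exclusive u v u<v v<u = <-asym (<ᵇ⇒< (toℕ u) (toℕ v) u<v) (<ᵇ⇒< (toℕ v) (toℕ u) v<u)

  exhaustive : ∀ u v → ¬ T (toℕ u <ᵇ toℕ v) → ¬ T (toℕ v <ᵇ toℕ u) → ¬ T (adj H u v)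
  exhaustive u v u≮v v≮u
    with refl ← toℕ-injective {i = u} {j = v}
                  (≤-antisym (≮⇒≥ (v≮u ∘ <⇒<ᵇ {toℕ v})) (≮⇒≥ (u≮v ∘ <⇒<ᵇ {toℕ u})))
    = subst T (adj-irref H u)

record Crossing {n} (G : Graph n) (S P : VertexSet n) : Set where
  constructor crossing
  field
    source target : Fin n
    source∈S      : T (S source)
    target∈S      : T (S target)
    source∈P      : T (P source)
    target∉P      : ¬ T (P target)
    edge          : T (adj G source target)

crossing-⊆ : ∀ {n} {G : Graph n} {S S' P} → S ⊆ S' → Crossing G S P → Crossing G S' P
crossing-⊆ S⊆S' (crossing u w u∈S w∈S u∈P w∉P u~w) =
  crossing u w (S⊆S' u u∈S) (S⊆S' w w∈S) u∈P w∉P u~w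

-- S is connected in G, in cut form: every colouring P that takes both values
-- on S takes both values on the two ends of some edge of G inside S.
Connects : ∀ {n} → Graph n → VertexSet n → Set
Connects {n} G S =
  ∀ (P : VertexSet n) {y z} → T (S y) → T (S z) → T (P y) → ¬ T (P z) → Crossing G S P

walk-crossing : ∀ {n} {G : Graph n} (P : VertexSet n) {y z m} → Walk G y z m →
  T (P y) → ¬ T (P z) → Crossing G full P
walk-crossing P nil                     y∈P z∉P = contradiction y∈P z∉P
walk-crossing P (cons {w = w} y~w walk) y∈P z∉P with T? (P w)
... | yes w∈P = walk-crossing P walk w∈P z∉P
... | no  w∉P = crossing _ w tt tt y∈P w∉P (from T-≡ y~w)

connected⇒connects : ∀ {n} {G : Graph n} → Connected G → Connects G full
connected⇒connects conn P {y} {z} _ _ = walk-crossing P (proj₂ (conn y z))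

singleton-connects : ∀ {n} {G : Graph n} r → Connects G (singleton r)
singleton-connects r P y∈ z∈ y∈P z∉P
  with refl ← singleton-member y∈ | refl ← singleton-member z∈ = contradiction y∈P z∉P

insert-connects : ∀ {n} {G : Graph n} {S : VertexSet n} {s x} →
  Connects G S → T (S s) → T (adj G s x) → Connects G (insert x S)
insert-connects {G = G} {S} {s} {x} S-conn s∈S s~x P {y} {z} y∈ z∈ y∈P z∉P
  with insert-cases S x y∈ | insert-cases S x z∈ | T? (P s)
... | inj₁ y∈S  | inj₁ z∈S  | _       = crossing-⊆ (⊆-insert S x) (S-conn P y∈S z∈S y∈P z∉P)
... | inj₂ refl | inj₂ refl | _       = contradiction y∈P z∉P
... | inj₂ refl | inj₁ z∈S  | yes s∈P = crossing-⊆ (⊆-insert S x) (S-conn P s∈S z∈S s∈P z∉P)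
... | inj₂ refl | inj₁ _    | no  s∉P =
  crossing x s (insert-new S x) (⊆-insert S x s s∈S) y∈P s∉P (adj-sym-T G s~x)
... | inj₁ _    | inj₂ refl | yes s∈P =
  crossing s x (⊆-insert S x s s∈S) (insert-new S x) s∈P z∉P s~x
... | inj₁ y∈S  | inj₂ refl | no  s∉P = crossing-⊆ (⊆-insert S x) (S-conn P y∈S s∈S y∈P s∉P)

module _ {n} (G : Graph n) {S : VertexSet n} (S-conn : Connects G S) {s} (s∈S : T (S s)) where

  ball : ℕ → VertexSet n
  ball i v = S v ∧ within G i s v

  ball-⊆ : ∀ i → ball i ⊆ ball (suc i)
  ball-⊆ i v v∈ball = let v∈S , near = to T-∧ v∈ball in from T-∧ (v∈S , within-weaken G i near)

  ball-size : ∀ i → suc i ⊓ size S ≤ size (ball i)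
  ball-size zero = begin
    1 ⊓ size S           ≤⟨ m⊓n≤m 1 (size S) ⟩
    1                    ≡⟨ size-singleton s ⟨
    size (singleton s)   ≤⟨ size-mono (singleton-⊆ {S = ball 0} (from T-∧ (s∈S , within-refl G 0))) ⟩
    size (ball 0)        ∎
    where open ≤-Reasoning
  ball-size (suc i) with ⊆-or-escape S (ball i)
  ... | inj₁ S⊆ball =
    ≤-trans (m⊓n≤n (2 + i) (size S)) (≤-trans (size-mono S⊆ball) (size-mono (ball-⊆ i)))
  ... | inj₂ (v , v∈S , v∉ball)
    with S-conn (λ w → within G i s w) s∈S v∈S (within-refl G i)
                (λ near → v∉ball (from T-∧ (v∈S , near)))
  ...   | crossing u w _ w∈S near-u far-w u~w = begin
    suc (suc i) ⊓ size S      ≤⟨ ⊓-monoʳ-≤ (2 + i) (n≤1+n (size S)) ⟩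
    suc (suc i ⊓ size S)      ≤⟨ s≤s (ball-size i) ⟩
    suc (size (ball i))       ≤⟨ size-grows (ball-⊆ i) (from T-∧ (w∈S , within-snoc G i near-u u~w))
                                              (far-w ∘ proj₂ ∘ to T-∧) ⟩
    size (ball (suc i))       ∎
    where open ≤-Reasoning

  -- A vertex x outside S attached to s has at least min(k, |S|) neighbours in S in G^k:
  -- every vertex of S within distance k - 1 of s is within distance k of x.
  attach-degree : ∀ k {x} → ¬ T (S x) → T (adj G s x) → k ⊓ size S ≤ degree (power G k) S x
  attach-degree zero    _   _   = z≤n
  attach-degree (suc j) {x} x∉S s~x = ≤-trans (ball-size j) (size-mono ball⊆neighbours)
    where
    ball⊆neighbours : ball j ⊆ neighbours (power G (suc j)) S x
    ball⊆neighbours v v∈ball =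
      let v∈S , near = to T-∧ v∈ball
      in from T-∧ (v∈S , power-adj G (suc j) (λ { refl → x∉S v∈S })
                                              (within-step G j (adj-sym-T G s~x) near))

-- deficit k m = (k ∸ m)(k ∸ m + 1). For m ≤ k, a complete graph on m vertices has
-- m(m - 1) = 2km - k(k+1) + deficit k m ordered pairs; for m ≥ k the deficit vanishes.
deficit : ℕ → ℕ → ℕ
deficit k m = (k ∸ m) * (k ∸ m + 1)

-- PairBound k m p: p ≥ 2km - k(k+1) + deficit k m, written without subtraction.
record PairBound (k m p : ℕ) : Set where
  constructor pair-bound
  field
    holds : 2 * (k * m) + deficit k m ≤ p + k * (k + 1)

-- Growing from m to m + 1 vertices costs 2k in the target and gains 2 min(k, m) pairs.
deficit-step : ∀ k m → 2 * k + deficit k (suc m) ≤ deficit k m + 2 * (k ⊓ m)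
deficit-step zero    m       = z≤n
deficit-step (suc k) zero    = ≤-reflexive (first k)
  where
  first : ∀ k → 2 * suc k + k * (k + 1) ≡ suc k * (suc k + 1) + 2 * 0
  first = solve-∀
deficit-step (suc k) (suc m) = begin
  2 * suc k + deficit k (suc m)     ≡⟨ shiftˡ k (deficit k (suc m)) ⟩
  2 + (2 * k + deficit k (suc m))   ≤⟨ +-monoʳ-≤ 2 (deficit-step k m) ⟩
  2 + (deficit k m + 2 * (k ⊓ m))   ≡⟨ shiftʳ (deficit k m) (k ⊓ m) ⟩
  deficit k m + 2 * suc (k ⊓ m)     ∎
  where
  open ≤-Reasoning
  shiftˡ : ∀ k d → 2 * suc k + d ≡ 2 + (2 * k + d)
  shiftˡ = solve-∀
  shiftʳ : ∀ d c → 2 + (d + 2 * c) ≡ d + 2 * suc c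
  shiftʳ = solve-∀

-- One vertex: 2k + (k - 1)k = k(k + 1).
bound-start : ∀ k {p} → PairBound k 1 p
bound-start zero        = pair-bound z≤n
bound-start (suc j) {p} = pair-bound (≤-trans (≤-reflexive (one j)) (m≤n+m _ p))
  where
  one : ∀ j → 2 * (suc j * 1) + j * (j + 1) ≡ suc j * (suc j + 1)
  one = solve-∀

bound-step : ∀ {k m p} → PairBound k m p → PairBound k (suc m) (p + 2 * (k ⊓ m))
bound-step {k} {m} {p} (pair-bound bound) = pair-bound $ begin
  2 * (k * suc m) + deficit k (suc m)        ≡⟨ cong (λ b → 2 * b + deficit k (suc m)) (*-suc k m) ⟩
  2 * (k + k * m) + deficit k (suc m)        ≡⟨ distribute (k * m) k (deficit k (suc m)) ⟩
  2 * (k * m) + (2 * k + deficit k (suc m))  ≤⟨ +-monoʳ-≤ (2 * (k * m)) (deficit-step k m) ⟩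
  2 * (k * m) + (deficit k m + 2 * (k ⊓ m))  ≡⟨ +-assoc (2 * (k * m)) (deficit k m) _ ⟨
  2 * (k * m) + deficit k m + 2 * (k ⊓ m)    ≤⟨ +-monoˡ-≤ (2 * (k ⊓ m)) bound ⟩
  p + k * (k + 1) + 2 * (k ⊓ m)              ≡⟨ +-comm-last p (k * (k + 1)) (2 * (k ⊓ m)) ⟩
  p + 2 * (k ⊓ m) + k * (k + 1)              ∎
  where
  open ≤-Reasoning
  distribute : ∀ a k d → 2 * (k + a) + d ≡ 2 * a + (2 * k + d)
  distribute = solve-∀
  +-comm-last : ∀ a b c → a + b + c ≡ a + c + b
  +-comm-last = solve-∀

bound-mono : ∀ {k m p p'} → p ≤ p' → PairBound k m p → PairBound k m p'
bound-mono {k} p≤p' (pair-bound bound) = pair-bound (≤-trans bound (+-monoˡ-≤ (k * (k + 1)) p≤p'))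

module _ {n} (G : Graph n) (G-conn : Connected G) (k : ℕ) where

  -- Grow a connected set S one attached vertex at a time until it is all of V(G);
  -- each new vertex brings 2 min(k, |S|) ordered pairs of G^k (attach-degree).
  grow : ∀ d (S : VertexSet n) {r} → size S + d ≡ n → T (S r) → Connects G S →
    PairBound k (size S) (pairs (power G k) S) → PairBound k n (pairs (power G k) full)
  grow zero S |S|+0≡n _ _ bound =
    subst (λ m → PairBound k m (pairs (power G k) full))
          (trans (sym (+-identityʳ (size S))) |S|+0≡n)
      (bound-mono (pairs-mono (power G k) {S} (λ _ _ → tt)) bound)
  grow (suc d) S {r} |S|+d≡n r∈S S-conn bound with ⊆-or-escape full S
  ... | inj₁ full⊆S =
    contradiction (subst (_≤ size S) (trans size-full (sym |S|+d≡n)) (size-mono full⊆S))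
                  (m+1+n≰m (size S))
  ... | inj₂ (_ , _ , y∉S) with connected⇒connects G-conn S tt tt r∈S y∉S
  ...   | crossing s x _ _ s∈S x∉S s~x =
    grow d (insert x S) |S'|+d≡n (⊆-insert S x r r∈S) (insert-connects S-conn s∈S s~x) bound'
    where
    |S'|+d≡n : size (insert x S) + d ≡ n
    |S'|+d≡n = trans (cong (_+ d) (size-insert {S = S} x∉S))
                     (trans (sym (+-suc (size S) d)) |S|+d≡n)

    bound' : PairBound k (size (insert x S)) (pairs (power G k) (insert x S))
    bound' = subst₂ (PairBound k) (sym (size-insert {S = S} x∉S))
                                  (sym (pairs-insert (power G k) {S} x∉S)) $
      bound-mono (+-monoʳ-≤ (pairs (power G k) S)
                            (*-monoʳ-≤ 2 (attach-degree G S-conn s∈S k x∉S s~x)))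
                 (bound-step bound)

connected-power-edges : ∀ {n} (G : Graph n) → Connected G → ∀ k →
  2 * (k * n) ≤ 2 * powEdges G k + k * (k + 1)
connected-power-edges {zero}  G _      k rewrite *-zeroʳ k = z≤n
connected-power-edges {suc n} G G-conn k = begin
  2 * (k * suc n)                         ≤⟨ m≤m+n (2 * (k * suc n)) (deficit k (suc n)) ⟩
  2 * (k * suc n) + deficit k (suc n)     ≤⟨ PairBound.holds whole ⟩
  pairs (power G k) full + k * (k + 1)    ≡⟨ cong (_+ k * (k + 1)) (handshake (power G k)) ⟨
  2 * powEdges G k + k * (k + 1)          ∎
  where
  open ≤-Reasoning
  root : Fin (suc n)
  root = zero

  initial : PairBound k (size (singleton root)) (pairs (power G k) (singleton root))
  initial = subst (λ m → PairBound k m (pairs (power G k) (singleton root)))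
                (sym (size-singleton root)) (bound-start k)

  whole : PairBound k (suc n) (pairs (power G k) full)
  whole = grow G G-conn k n (singleton root) {root} (cong (_+ n) (size-singleton root))
               (singleton-self root) (singleton-connects root) initial

lemma2p2 : ∀ (n : ℕ) (T : Graph n) → IsTree T → ∀ (k : ℕ) → 1 ≤ k →
    2 * (k * n) ≤ 2 * powEdges T k + k * (k + 1)
lemma2p2 n T (T-connected , _) k _ = connected-power-edges T T-connected k
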